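{- Let $G$ be a finite, simple, connected graph with $v$ vertices, let $k\ge 2$, and let $\mathscr{B}=\Upsilon\cup\Omega$ be the set of Cartesian squares in $G^{(k)}$ constructed from a breadth-first-labelled rooted spanning tree $T$ as described below. Then $\mathscr{B}$ is a basis of the square space $\mathscr{S}(G^{(k)})$, and moreover $\mathscr{S}(G^{(k)})=\ker(p^*)$.
   Context: The cycle space $\mathscr{C}(H)$ of a graph $H$ is the kernel of the $\mathbb{F}_2$-linear boundary map from the edge space $\mathscr{E}(H)$ (subsets of $E(H)$, addition = symmetric difference) to the vertex space, $xy\mapsto x+y$. $M_k(a_1,\ldots,a_j)$ is the set of monic monomials of degree $k$ in commuting indeterminates $a_1,\ldots,a_j$ ($M_0=\{1\}$), and $M_k(G)=M_k(a_1,\ldots,a_v)$ where $V(G)=\{a_1,\ldots,a_v\}$. The reduced $k$th power $G^{(k)}$ has vertex set $M_k(G)$, with an edge between $ag$ and $bg$ for every edge $ab$ of $G$ and every $g\in M_{k-1}(G)$ (and no others). For distinct edges $ab,cd$ of $G$ and $f\in M_{k-2}(G)$, the Cartesian square $(ab\Box cd)f\in\mathscr{C}(G^{(k)})$ is the sum of the edges $acf\,bcf$, $bcf\,bdf$, $bdf\,adf$, $adf\,acf$. The square space $\mathscr{S}(G^{(k)})$ is the subspace of $\mathscr{C}(G^{(k)})$ spanned by all Cartesian squares. The map $p^*:\mathscr{C}(G^{(k)})\to\mathscr{C}(G)$ is the restriction to the cycle space of the linear map $\mathscr{E}(G^{(k)})\to\mathscr{E}(G)$ with $p^*(ag\;bg)=ab$.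 Construction of $\mathscr{B}$: take a rooted spanning tree $T$ of $G$ with the vertices labelled $a_1,\ldots,a_v$ so that $a_1$ is the root and for each $i$, $a_i$ is not closer to the root than any $a_j$ with $j<i$; for $2\le j\le v$ let $e_j$ be the edge of $T$ joining $a_j$ to its neighbour closer to the root; set $\Upsilon=\{(e_i\Box e_j)f \mid 2\le i<j\le v,\ f\in M_{k-2}(a_1,\ldots,a_j)\}$ and $\Omega=\{(a_\ell a_m\Box e_j)f \mid a_\ell a_m\in E(G)\setminus E(T),\ 2\le j\le v,\ f\in M_{k-2}(a_1,\ldots,a_j)\}$. -}

module Defs where

open import Data.Bool using (Bool; true; false; T; not; _∧_; _∨_; _xor_; if_then_else_)
open import Data.Nat using (ℕ; zero; suc; _+_; _∸_; _≤_; _<_; z≤n; s≤s)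
open import Data.Nat.Properties using (+-suc; <-trans)
open import Data.Fin using (Fin; zero; suc; toℕ)
import Data.Fin as Fin
import Data.Nat as Nat
open import Data.Vec using (Vec; []; _∷_; updateAt; sum)
import Data.Vec.Properties as VecP
open import Data.List using (List; []; _∷_; concat; map; concatMap)
open import Data.List.Relation.Unary.Unique.Propositional using (Unique)
open import Data.Product using (Σ; _,_; proj₁; proj₂; ∃; _×_)
open import Data.Sum using (_⊎_; inj₁; inj₂)
open import Relation.Nullary.Decidable using (⌊_⌋)
open import Relation.Binary.PropositionalEquality using (_≡_; refl; cong; trans)
open import Function.Bundles using (_⇔_)

-- Finite simple graphs on the vertex set Fin v  (vertex i = a_{i+1})

record SimpleGraph (v : ℕ) : Set where
  field
    adj    : Fin v → Fin v → Bool
    sym    : ∀ a b → adj a b ≡ adj b a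
    irrefl : ∀ a → adj a a ≡ false
open SimpleGraph public

Adj : ∀ {v} → SimpleGraph v → Fin v → Fin v → Set
Adj G a b = T (adj G a b)

_==_ : ∀ {v} → Fin v → Fin v → Bool
a == b = ⌊ a Fin.≟ b ⌋

samePair : ∀ {v} → Fin v → Fin v → Fin v → Fin v → Bool
samePair a b c d = ((a == c) ∧ (b == d)) ∨ ((a == d) ∧ (b == c))

-- Monic monomials of degree d in a_1..a_v, as exponent vectors.

Mon : ℕ → ℕ → Set
Mon v d = Σ (Vec ℕ v) (λ e → sum e ≡ d)

_==M_ : ∀ {v d} → Mon v d → Mon v d → Bool
f ==M g = ⌊ VecP.≡-dec Nat._≟_ (proj₁ f) (proj₁ g) ⌋

sum-updateAt-suc : ∀ {v} (e : Vec ℕ v) (a : Fin v) → sum (updateAt e a suc) ≡ suc (sum e)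
sum-updateAt-suc (x ∷ e) zero = refl
sum-updateAt-suc (x ∷ e) (suc a) = trans (cong (x +_) (sum-updateAt-suc e a)) (+-suc x (sum e))

mulVar : ∀ {v d} → Fin v → Mon v d → Mon v (suc d)
mulVar a (e , p) = updateAt e a suc , trans (sum-updateAt-suc e a) (cong suc p)

-- f ∈ M_d(a_1,…,a_{j+1}) : all exponents at positions > j vanish
allZero : ∀ {n} → Vec ℕ n → Bool
allZero [] = true
allZero (x ∷ xs) = ⌊ x Nat.≟ 0 ⌋ ∧ allZero xs

vanishesAbove : ∀ {n} → Fin n → Vec ℕ n → Bool
vanishesAbove zero (x ∷ xs) = allZero xs
vanishesAbove (suc j) (x ∷ xs) = vanishesAbove j xs

InFirst : ∀ {v d} → Fin v → Mon v d → Set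
InFirst j f = T (vanishesAbove j (proj₁ f))

-- Edge spaces over F₂, as formal sums (lists) modulo 2.

parity : ∀ {A : Set} → (A → Bool) → List A → Bool
parity p [] = false
parity p (x ∷ xs) = p x xor parity p xs

-- Rooted spanning tree T of G (root a_1 = zero), given by parent
-- pointers and depth (= distance in T to the root), labelled so that
-- depth is non-decreasing along the labelling (breadth-first labelling).

record BFSTree {n : ℕ} (G : SimpleGraph (suc n)) : Set where
  field
    parent       : Fin (suc n) → Fin (suc n)
    depth        : Fin (suc n) → ℕ
    depth-root   : depth zero ≡ 0
    depth-parent : ∀ j → 0 < toℕ j → depth j ≡ suc (depth (parent j))
    parent-adj   : ∀ j → 0 < toℕ j → Adj G j (parent j)
    labelling    : ∀ i j → toℕ i ≤ toℕ j → depth i ≤ depth j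
open BFSTree public

isNonRoot : ∀ {n} → Fin (suc n) → Bool
isNonRoot zero = false
isNonRoot (suc _) = true

isTreeEdge : ∀ {n} {G : SimpleGraph (suc n)} → BFSTree G → Fin (suc n) → Fin (suc n) → Bool
isTreeEdge Tr a b = (isNonRoot b ∧ (parent Tr b == a)) ∨ (isNonRoot a ∧ (parent Tr a == b))

module _ {v : ℕ} (G : SimpleGraph v) (k : ℕ) where

  -- edge  ag — bg  of G^(k)  (ab ∈ E(G), g ∈ M_{k-1}(G))
  record EdgeK : Set where
    constructor edgeK
    field
      src tgt : Fin v
      isAdj   : Adj G src tgt
      mon     : Mon v (k ∸ 1)
  open EdgeK public

  sameEdgeK : EdgeK → EdgeK → Bool
  sameEdgeK e e' = samePair (src e) (tgt e) (src e') (tgt e') ∧ (mon e ==M mon e')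

  -- element of the edge space ℰ(G^(k)) : formal F₂-sum of edges
  EK : Set
  EK = List EdgeK

  _≈K_ : EK → EK → Set
  x ≈K y = ∀ e → parity (sameEdgeK e) x ≡ parity (sameEdgeK e) y

  VK : Set
  VK = List (Mon v k)

  mulVar₁ : 1 ≤ k → Fin v → Mon v (k ∸ 1) → Mon v k
  mulVar₁ (s≤s z≤n) a g = mulVar a g

  boundary : 1 ≤ k → EK → VK
  boundary hk = concatMap (λ e → mulVar₁ hk (src e) (mon e) ∷ mulVar₁ hk (tgt e) (mon e) ∷ [])

  InCycleSpace : 1 ≤ k → EK → Set
  InCycleSpace hk x = ∀ (w : Mon v k) → parity (λ w' → w ==M w') (boundary hk x) ≡ false

  record EdgeG : Set where
    constructor edgeG
    field
      srcG tgtG : Fin v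
      isAdjG    : Adj G srcG tgtG
  open EdgeG public

  _≈G_ : List EdgeG → List EdgeG → Set
  x ≈G y = ∀ e → parity (λ e' → samePair (srcG e) (tgtG e) (srcG e') (tgtG e')) x
               ≡ parity (λ e' → samePair (srcG e) (tgtG e) (srcG e') (tgtG e')) y

  pStar : EK → List EdgeG
  pStar = map (λ e → edgeG (src e) (tgt e) (isAdj e))

  mulVar₂ : 2 ≤ k → Fin v → Mon v (k ∸ 2) → Mon v (k ∸ 1)
  mulVar₂ (s≤s (s≤s z≤n)) a f = mulVar a f

  -- (ab □ cd) f  =  acf bcf + bcf bdf + bdf adf + adf acf
  square : 2 ≤ k → (a b c d : Fin v) → Adj G a b → Adj G c d → Mon v (k ∸ 2) → EK
  square hk a b c d ab cd f =
      edgeK a b ab (mulVar₂ hk c f)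
    ∷ edgeK c d cd (mulVar₂ hk b f)
    ∷ edgeK a b ab (mulVar₂ hk d f)
    ∷ edgeK c d cd (mulVar₂ hk a f)
    ∷ []

  record SquareIndex : Set where
    constructor sqIdx
    field
      a b c d  : Fin v
      ab       : Adj G a b
      cd       : Adj G c d
      distinct : T (not (samePair a b c d))
      f        : Mon v (k ∸ 2)

  squareOf : 2 ≤ k → SquareIndex → EK
  squareOf hk (sqIdx a b c d ab cd _ f) = square hk a b c d ab cd f

  InSquareSpace : 2 ≤ k → EK → Set
  InSquareSpace hk x = ∃ λ (l : List SquareIndex) → concat (map (squareOf hk) l) ≈K x

  record IsBasisOfSquareSpace (hk : 2 ≤ k) {I : Set} (b : I → EK) : Set where
    field
      inSpace : ∀ i → InSquareSpace hk (b i)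
      linIndep : ∀ (l : List I) → Unique l → concat (map b l) ≈K [] → l ≡ []
      spans : ∀ x → InSquareSpace hk x → ∃ λ (l : List I) → concat (map b l) ≈K x

module _ {n : ℕ} (G : SimpleGraph (suc n)) (Tr : BFSTree G) (k : ℕ) where

  treeEdgeAdj : (j : Fin (suc n)) → 0 < toℕ j → Adj G j (parent Tr j)
  treeEdgeAdj = parent-adj Tr

  -- Υ : (e_i □ e_j) f,  2 ≤ i < j ≤ v,  f ∈ M_{k-2}(a_1,…,a_j)
  record UpsilonIndex : Set where
    constructor υ
    field
      i j     : Fin (suc n)
      i-nonroot : 0 < toℕ i
      i<j     : toℕ i < toℕ j
      f       : Mon (suc n) (k ∸ 2)
      f-supp  : InFirst j f

  -- Ω : (a_ℓ a_m □ e_j) f,  a_ℓ a_m ∈ E(G) ∖ E(T),  2 ≤ j ≤ v,  f ∈ M_{k-2}(a_1,…,a_j)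
  record OmegaIndex : Set where
    constructor ω
    field
      ℓ m       : Fin (suc n)
      ℓ<m       : toℕ ℓ < toℕ m
      ℓm-adj    : Adj G ℓ m
      ℓm-nontree : T (not (isTreeEdge Tr ℓ m))
      j         : Fin (suc n)
      j-nonroot : 0 < toℕ j
      f         : Mon (suc n) (k ∸ 2)
      f-supp    : InFirst j f

  𝓑 : 2 ≤ k → UpsilonIndex ⊎ OmegaIndex → EK G k
  𝓑 hk (inj₁ (υ i j i0 i<j f _)) =
    square G k hk i (parent Tr i) j (parent Tr j)
      (treeEdgeAdj i i0) (treeEdgeAdj j (<-trans i0 i<j)) f
  𝓑 hk (inj₂ (ω ℓ m _ ℓm _ j j0 f _)) =
    square G k hk ℓ m j (parent Tr j) ℓm (treeEdgeAdj j j0) f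

module Submission where

-- Elements of ℰ(G^(k)) are lists read as F₂-formal sums, compared through their coefficients.
-- After general facts on such sums (Parity, FormalSums), on lexicographic maxima (Lex) and on
-- exponent vectors (Monomials), the argument has four steps:
--  * Squares: every Cartesian square is a cycle annihilated by p*, so 𝒮 ⊆ 𝒞 ∩ ker p*.
--  * Reduction: modulo the span of ℬ every edge is congruent to a sum of canonical edges
--    e_i·g with g ∈ M(a_1,…,a_i) and a_ℓa_m·a_1^{k-1} (a_ℓa_m ∉ T), by induction on a weight
--    of the monomial that decreases when a variable is replaced by that of its parent.
--  * Rigidity: a canonical sum lying in 𝒞 ∩ ker p* is zero.  Hence 𝒞 ∩ ker p* ⊆ span ℬ ⊆ 𝒮.
--  * Independence: each member of ℬ has a leading term that outranks its other terms and
--    determines the member, so no nonempty sum of distinct members vanishes.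

open import Data.Bool using (Bool; true; false; T; not; _∧_; _∨_; _xor_; if_then_else_)
open import Data.Bool.Properties using (xor-assoc; xor-same; xor-identityʳ; ∧-identityʳ; ∧-zeroʳ; ∧-idem; ∨-comm; ∨-zeroʳ; T-irrelevant)
open import Data.Bool.Solver using (module xor-∧-Solver)
open import Data.Nat using (ℕ; zero; suc; _+_; _≤_; _<_; z≤n; s≤s)
open import Data.Nat.Properties using (≤-refl; ≤-trans; <-trans; <-≤-trans; ≤-<-trans; <-irrefl; ≤-total; <-cmp; ≰⇒>; <⇒≤; +-monoˡ-<; ≤-irrelevant; ≡-irrelevant; suc-injective; +-identityʳ; +-suc; +-assoc; +-comm; +-monoʳ-≤; n≤1+n)
open import Data.Nat.Induction using (<-wellFounded)
open import Data.Fin using (Fin; zero; suc; toℕ)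
import Data.Fin as Fin
import Data.Nat as Nat
open import Data.Fin.Properties using (toℕ-injective; <⇒≢)
open import Data.Vec using (Vec; []; _∷_; updateAt; sum; lookup; head; tail)
import Data.Vec.Properties as VecP
open import Data.Vec.Properties using (lookup∘updateAt; lookup∘updateAt′; tabulate∘lookup; tabulate-cong)
open import Data.List using (List; []; _∷_; _++_; concat; map; length; filterᵇ)
open import Data.List.Properties using (length-++; ++-identityʳ; ++-assoc)
open import Data.List.Membership.Propositional using (_∈_)
open import Data.List.Membership.Propositional.Properties using (∈-filter⁺; ∈-filter⁻)
open import Data.List.Relation.Unary.Any using (here; there)
open import Data.List.Relation.Unary.All as All using (All; []; _∷_)
open import Data.List.Relation.Unary.All.Properties using (++⁺)
open import Data.List.Relation.Unary.AllPairs using ([]; _∷_)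
open import Data.List.Relation.Unary.Unique.Propositional using (Unique)
open import Data.Product using (Σ; _,_; proj₁; proj₂; ∃; _×_)
open import Data.Sum using (_⊎_; inj₁; inj₂)
open import Data.Empty using (⊥; ⊥-elim)
open import Data.Unit using (tt)
open import Function.Bundles using (_⇔_; mk⇔; Equivalence)
open import Induction.WellFounded using (Acc; acc)
open import Relation.Nullary.Decidable using (Dec; T?; ⌊_⌋; isYes≗does; dec-true; toWitness)
open import Relation.Binary.Definitions using (tri<; tri≈; tri>)
open import Relation.Binary.PropositionalEquality using (_≡_; _≢_; refl; cong; cong₂; sym; trans; subst; ≢-sym; module ≡-Reasoning)
open import Defs hiding (sym)

true≢false : true ≢ false
true≢false ()

suc≢zero : ∀ {n} → suc n ≢ 0
suc≢zero ()

module Parity {A : Set} where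

  parity-++ : (p : A → Bool) (xs ys : List A) → parity p (xs ++ ys) ≡ parity p xs xor parity p ys
  parity-++ p [] ys = refl
  parity-++ p (x ∷ xs) ys = trans (cong (p x xor_) (parity-++ p xs ys)) (sym (xor-assoc (p x) _ _))

  parity-xor : (p q : A → Bool) (xs : List A) → parity (λ x → p x xor q x) xs ≡ parity p xs xor parity q xs
  parity-xor p q [] = refl
  parity-xor p q (x ∷ xs) rewrite parity-xor p q xs =
    solve 4 (λ a b c d → (a :+ b) :+ (c :+ d) := (a :+ c) :+ (b :+ d)) refl (p x) (q x) (parity p xs) (parity q xs)
    where open xor-∧-Solver

  parity-cong : (p q : A → Bool) (xs : List A) → (∀ x → x ∈ xs → p x ≡ q x) → parity p xs ≡ parity q xs
  parity-cong p q [] h = refl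
  parity-cong p q (x ∷ xs) h = cong₂ _xor_ (h x (here refl)) (parity-cong p q xs (λ y m → h y (there m)))

  parity-false : (p : A → Bool) (xs : List A) → (∀ x → x ∈ xs → p x ≡ false) → parity p xs ≡ false
  parity-false p xs h = trans (parity-cong p (λ _ → false) xs h) (parity-const xs)
    where
      parity-const : (ys : List A) → parity (λ _ → false) ys ≡ false
      parity-const [] = refl
      parity-const (_ ∷ ys) = parity-const ys

  parity-split : (p : A → Bool) (xs : List A) → parity p xs ≡ true →
    Σ (List A) λ u → Σ (List A) λ w → Σ A λ d → (xs ≡ u ++ d ∷ w) × p d ≡ true
  parity-split p (x ∷ xs) h with p x in px
  ... | true = [] , xs , x , refl , px
  ... | false with parity-split p xs h
  ...   | u , w , d , refl , pd = x ∷ u , w , d , refl , pd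

  parity-true : (p : A → Bool) (xs : List A) → parity p xs ≡ true → ∃ λ d → d ∈ xs × p d ≡ true
  parity-true p xs h with parity-split p xs h
  ... | u , w , d , refl , pd = d , member u , pd
    where
      member : ∀ u → d ∈ u ++ d ∷ w
      member [] = here refl
      member (_ ∷ u) = there (member u)

  parity-filter : (p q : A → Bool) (xs : List A) → parity p (filterᵇ q xs) ≡ parity (λ x → p x ∧ q x) xs
  parity-filter p q [] = refl
  parity-filter p q (x ∷ xs) with q x
  ... | true  rewrite ∧-identityʳ (p x) = cong (p x xor_) (parity-filter p q xs)
  ... | false rewrite ∧-zeroʳ (p x) = parity-filter p q xs

  parity-∧ʳ : (p : A → Bool) (c : Bool) (xs : List A) → parity (λ x → p x ∧ c) xs ≡ parity p xs ∧ c
  parity-∧ʳ p c [] = refl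
  parity-∧ʳ p c (x ∷ xs) rewrite parity-∧ʳ p c xs =
    solve 3 (λ a b c → (a :* c) :+ (b :* c) := (a :+ b) :* c) refl (p x) (parity p xs) c
    where open xor-∧-Solver

  parity-unique-hit : (p : A → Bool) (a : A) (xs : List A) → Unique xs → a ∈ xs → p a ≡ true →
    (∀ y → y ∈ xs → p y ≡ true → y ≡ a) → parity p xs ≡ true
  parity-unique-hit p a (y ∷ xs) (y∉xs ∷ uxs) a∈ pa only with p y in py
  ... | true = cong not (parity-false p xs others-false)
    where
      others-false : ∀ z → z ∈ xs → p z ≡ false
      others-false z z∈ with p z in pz
      ... | false = refl
      ... | true = ⊥-elim (All.lookup y∉xs z∈ (trans (only y (here refl) py) (sym (only z (there z∈) pz))))
  ... | false with a∈
  ...   | here refl = ⊥-elim (true≢false (trans (sym pa) py))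
  ...   | there a∈xs = parity-unique-hit p a xs uxs a∈xs pa (λ z z∈ → only z (there z∈))

module _ {A B : Set} where

  parity-map : (p : B → Bool) (f : A → B) (xs : List A) → parity p (map f xs) ≡ parity (λ x → p (f x)) xs
  parity-map p f [] = refl
  parity-map p f (x ∷ xs) = cong (p (f x) xor_) (parity-map p f xs)

  parity-concatMap : (p : B → Bool) (f : A → List B) (xs : List A) →
    parity p (concat (map f xs)) ≡ parity (λ x → parity p (f x)) xs
  parity-concatMap p f [] = refl
  parity-concatMap p f (x ∷ xs) =
    trans (Parity.parity-++ p (f x) (concat (map f xs))) (cong (parity p (f x) xor_) (parity-concatMap p f xs))

module Lex where

  _≤ₗ_ : ℕ × ℕ → ℕ × ℕ → Set
  (a , b) ≤ₗ (c , d) = a < c ⊎ (a ≡ c × b ≤ d)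

  _<ₗ_ : ℕ × ℕ → ℕ × ℕ → Set
  (a , b) <ₗ (c , d) = a < c ⊎ (a ≡ c × b < d)

  ≤ₗ-refl : ∀ x → x ≤ₗ x
  ≤ₗ-refl (a , b) = inj₂ (refl , ≤-refl)

  ≤ₗ-total : ∀ x y → x ≤ₗ y ⊎ y ≤ₗ x
  ≤ₗ-total (a , b) (c , d) with <-cmp a c | ≤-total b d
  ... | tri< a<c _ _ | _ = inj₁ (inj₁ a<c)
  ... | tri> _ _ c<a | _ = inj₂ (inj₁ c<a)
  ... | tri≈ _ refl _ | inj₁ b≤d = inj₁ (inj₂ (refl , b≤d))
  ... | tri≈ _ refl _ | inj₂ d≤b = inj₂ (inj₂ (refl , d≤b))

  ≤ₗ-trans : ∀ {x y z} → x ≤ₗ y → y ≤ₗ z → x ≤ₗ z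
  ≤ₗ-trans (inj₁ p) (inj₁ q) = inj₁ (<-trans p q)
  ≤ₗ-trans (inj₁ p) (inj₂ (refl , _)) = inj₁ p
  ≤ₗ-trans (inj₂ (refl , _)) (inj₁ q) = inj₁ q
  ≤ₗ-trans (inj₂ (refl , p)) (inj₂ (refl , q)) = inj₂ (refl , ≤-trans p q)

  <ₗ-≤ₗ-trans : ∀ {x y z} → x <ₗ y → y ≤ₗ z → x <ₗ z
  <ₗ-≤ₗ-trans (inj₁ p) (inj₁ q) = inj₁ (<-trans p q)
  <ₗ-≤ₗ-trans (inj₁ p) (inj₂ (refl , _)) = inj₁ p
  <ₗ-≤ₗ-trans (inj₂ (refl , _)) (inj₁ q) = inj₁ q
  <ₗ-≤ₗ-trans (inj₂ (refl , p)) (inj₂ (refl , q)) = inj₂ (refl , <-≤-trans p q)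

  <ₗ-irrefl : ∀ x → x <ₗ x → ⊥
  <ₗ-irrefl (a , b) (inj₁ p) = <-irrefl refl p
  <ₗ-irrefl (a , b) (inj₂ (_ , p)) = <-irrefl refl p

  maximum : ∀ {A : Set} (key : A → ℕ × ℕ) {a : A} (xs : List A) → a ∈ xs →
    Σ A λ m → m ∈ xs × All (λ y → key y ≤ₗ key m) xs
  maximum key (x ∷ []) _ = x , here refl , ≤ₗ-refl (key x) ∷ []
  maximum key (x ∷ y ∷ ys) _ with maximum key (y ∷ ys) (here refl)
  ... | m , m∈ , bound with ≤ₗ-total (key x) (key m)
  ...   | inj₁ x≤m = m , there m∈ , x≤m ∷ bound
  ...   | inj₂ m≤x = x , here refl , ≤ₗ-refl (key x) ∷ All.map (λ y≤m → ≤ₗ-trans y≤m m≤x) bound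

module Monomials where

  infixl 7 _*ˣ_
  _*ˣ_ : ∀ {m} → Vec ℕ m → Fin m → Vec ℕ m
  e *ˣ a = updateAt e a suc

  *ˣ-comm : ∀ {m} (e : Vec ℕ m) (a b : Fin m) → e *ˣ a *ˣ b ≡ e *ˣ b *ˣ a
  *ˣ-comm (x ∷ e) zero    zero    = refl
  *ˣ-comm (x ∷ e) zero    (suc b) = refl
  *ˣ-comm (x ∷ e) (suc a) zero    = refl
  *ˣ-comm (x ∷ e) (suc a) (suc b) = cong (x ∷_) (*ˣ-comm e a b)

  *ˣ-cancel : ∀ {m} (e e' : Vec ℕ m) (a : Fin m) → e *ˣ a ≡ e' *ˣ a → e ≡ e'
  *ˣ-cancel (x ∷ e) (.x ∷ e') zero refl = refl
  *ˣ-cancel (x ∷ e) (y ∷ e') (suc a) eq =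
    cong₂ _∷_ (cong head eq) (*ˣ-cancel e e' a (cong tail eq))

  lookup-*ˣ-same : ∀ {m} (e : Vec ℕ m) (a : Fin m) → lookup (e *ˣ a) a ≡ suc (lookup e a)
  lookup-*ˣ-same e a = lookup∘updateAt a e

  lookup-*ˣ-other : ∀ {m} (e : Vec ℕ m) {a t : Fin m} → t ≢ a → lookup (e *ˣ a) t ≡ lookup e t
  lookup-*ˣ-other e {a} {t} t≢a = lookup∘updateAt′ t a t≢a e

  vec-ext : ∀ {m} (xs ys : Vec ℕ m) → (∀ t → lookup xs t ≡ lookup ys t) → xs ≡ ys
  vec-ext xs ys h = trans (sym (tabulate∘lookup xs)) (trans (tabulate-cong h) (tabulate∘lookup ys))

  -- Supported j e: no variable after the j-th occurs in e, i.e. e ∈ M(a_1, …, a_j) in the paper's labels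
  Supported : ∀ {m} → Fin m → Vec ℕ m → Set
  Supported j e = T (vanishesAbove j e)

  private
    allZero⇒zero : ∀ {m} (e : Vec ℕ m) → T (allZero e) → ∀ t → lookup e t ≡ 0
    allZero⇒zero (zero ∷ e) h zero    = refl
    allZero⇒zero (zero ∷ e) h (suc t) = allZero⇒zero e h t

    zero⇒allZero : ∀ {m} (e : Vec ℕ m) → (∀ t → lookup e t ≡ 0) → T (allZero e)
    zero⇒allZero [] h = tt
    zero⇒allZero (x ∷ e) h with h zero
    ... | refl = zero⇒allZero e (λ t → h (suc t))

    sum-allZero : ∀ {m} (e : Vec ℕ m) → T (allZero e) → sum e ≡ 0
    sum-allZero [] h = refl
    sum-allZero (zero ∷ e) h = sum-allZero e h

  supported⇒zero : ∀ {m} {j : Fin m} (e : Vec ℕ m) → Supported j e → ∀ t → toℕ j < toℕ t → lookup e t ≡ 0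
  supported⇒zero {j = zero}  (x ∷ e) h (suc t) _         = allZero⇒zero e h t
  supported⇒zero {j = suc j} (x ∷ e) h (suc t) (s≤s j<t) = supported⇒zero e h t j<t

  zero⇒supported : ∀ {m} (j : Fin m) (e : Vec ℕ m) → (∀ t → toℕ j < toℕ t → lookup e t ≡ 0) → Supported j e
  zero⇒supported zero    (x ∷ e) h = zero⇒allZero e (λ t → h (suc t) (s≤s z≤n))
  zero⇒supported (suc j) (x ∷ e) h = zero⇒supported j e (λ t j<t → h (suc t) (s≤s j<t))

  supported-*ˣ : ∀ {m} {j t : Fin m} (e : Vec ℕ m) → Supported j e → toℕ t ≤ toℕ j → Supported j (e *ˣ t)
  supported-*ˣ {j = j} {t} e h t≤j = zero⇒supported j (e *ˣ t) λ u j<u →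
    trans (lookup-*ˣ-other e (≢-sym (<⇒≢ (≤-<-trans t≤j j<u)))) (supported⇒zero e h u j<u)

  supported-mono : ∀ {m} {j i : Fin m} (e : Vec ℕ m) → Supported j e → toℕ j ≤ toℕ i → Supported i e
  supported-mono {i = i} e h j≤i = zero⇒supported i e (λ u i<u → supported⇒zero e h u (≤-<-trans j≤i i<u))

  supported-root-unique : ∀ {m} (e e' : Vec ℕ (suc m)) → Supported zero e → Supported zero e' → sum e ≡ sum e' → e ≡ e'
  supported-root-unique (x ∷ e) (y ∷ e') h h' deg rewrite sum-allZero e h | sum-allZero e' h' =
    cong₂ _∷_ (trans (sym (+-identityʳ x)) (trans deg (+-identityʳ y)))
              (vec-ext e e' (λ t → trans (allZero⇒zero e h t) (sym (allZero⇒zero e' h' t))))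

  split-last-variable : ∀ {m} (e : Vec ℕ m) (d : ℕ) → sum e ≡ suc d →
    Σ (Fin m) λ j → Σ (Vec ℕ m) λ f → sum f ≡ d × f *ˣ j ≡ e × Supported j f
  split-last-variable (x ∷ e) d deg with allZero e in az
  split-last-variable (zero ∷ e) d deg | true with () ← trans (sym (sum-allZero e (subst T (sym az) tt))) deg
  split-last-variable (suc x ∷ e) d deg | true = zero , x ∷ e , suc-injective deg , refl , subst T (sym az) tt
  ... | false with positive e az
    where
      positive : ∀ {m} (e : Vec ℕ m) → allZero e ≡ false → Σ ℕ λ d' → sum e ≡ suc d'
      positive (zero ∷ e) h = positive e h
      positive (suc x ∷ e) h = x + sum e , refl
  ...   | d' , deg' with split-last-variable e d' deg'
  ...     | j , f , refl , refl , supp =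
    suc j , x ∷ f , suc-injective (trans (sym (+-suc x (sum f))) (trans (cong (x +_) (sym (sum-updateAt-suc f j))) deg)) , refl , supp

  split-unique : ∀ {m} (f f' : Vec ℕ m) (j j' : Fin m) → f *ˣ j ≡ f' *ˣ j' →
    Supported j f → Supported j' f' → j ≡ j' × f ≡ f'
  split-unique f f' j j' eq h h' with <-cmp (toℕ j) (toℕ j')
  ... | tri≈ _ j≡j' _ with toℕ-injective j≡j'
  ...   | refl = refl , *ˣ-cancel f f' j eq
  split-unique f f' j j' eq h h' | tri< j<j' _ _ = ⊥-elim (suc≢zero (begin
      suc (lookup f' j')   ≡⟨ sym (lookup-*ˣ-same f' j') ⟩
      lookup (f' *ˣ j') j' ≡⟨ cong (λ z → lookup z j') (sym eq) ⟩
      lookup (f *ˣ j) j'   ≡⟨ lookup-*ˣ-other f (≢-sym (<⇒≢ j<j')) ⟩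
      lookup f j'          ≡⟨ supported⇒zero f h j' j<j' ⟩
      0 ∎))
    where open ≡-Reasoning
  split-unique f f' j j' eq h h' | tri> _ _ j'<j = ⊥-elim (suc≢zero (begin
      suc (lookup f j)     ≡⟨ sym (lookup-*ˣ-same f j) ⟩
      lookup (f *ˣ j) j    ≡⟨ cong (λ z → lookup z j) eq ⟩
      lookup (f' *ˣ j') j  ≡⟨ lookup-*ˣ-other f' (≢-sym (<⇒≢ j'<j)) ⟩
      lookup f' j          ≡⟨ supported⇒zero f' h' j j'<j ⟩
      0 ∎))
    where open ≡-Reasoning

  -- weight(a_1^{e_1}⋯a_m^{e_m}) = Σ (t-1)·e_t; moving a factor to a lower-indexed variable decreases it
  weight : ∀ {m} → Vec ℕ m → ℕ
  weight [] = 0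
  weight (x ∷ e) = sum e + weight e

  weight-*ˣ : ∀ {m} (e : Vec ℕ m) (a : Fin m) → weight (e *ˣ a) ≡ toℕ a + weight e
  weight-*ˣ (x ∷ e) zero = refl
  weight-*ˣ (x ∷ e) (suc a) rewrite sum-updateAt-suc e a | weight-*ˣ e a =
    cong suc (+-comm-middle (sum e) (toℕ a) (weight e))
    where
      +-comm-middle : ∀ s t w → s + (t + w) ≡ t + (s + w)
      +-comm-middle s t w = trans (sym (+-assoc s t w)) (trans (cong (_+ w) (+-comm s t)) (+-assoc t s w))

  weight-*ˣ-< : ∀ {m} (e : Vec ℕ m) {a b : Fin m} → toℕ a < toℕ b → weight (e *ˣ a) < weight (e *ˣ b)
  weight-*ˣ-< e {a} {b} a<b rewrite weight-*ˣ e a | weight-*ˣ e b = +-monoˡ-< (weight e) a<b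

bool-ext : ∀ {x y : Bool} → (x ≡ true → y ≡ true) → (y ≡ true → x ≡ true) → x ≡ y
bool-ext {false} {false} _ _ = refl
bool-ext {false} {true}  _ y⇒x = y⇒x refl
bool-ext {true}  {false} x⇒y _ = sym (x⇒y refl)
bool-ext {true}  {true}  _ _ = refl

T⇒≡true : ∀ {a} → T a → a ≡ true
T⇒≡true {true} _ = refl

T-not⇒≡false : ∀ {a} → T (not a) → a ≡ false
T-not⇒≡false {false} _ = refl

not-false : ∀ {a} → not a ≡ false → a ≡ true
not-false {true} _ = refl

∧-true : ∀ a b → a ∧ b ≡ true → a ≡ true × b ≡ true
∧-true true true _ = refl , refl

∨-true : ∀ a b → a ∨ b ≡ true → a ≡ true ⊎ b ≡ true
∨-true true  _ _ = inj₁ refl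
∨-true false _ h = inj₂ h

module EqualityTests where

  does-true : ∀ {P : Set} (p? : Dec P) → ⌊ p? ⌋ ≡ true → P
  does-true p? h = toWitness (subst T (sym h) tt)

  true-does : ∀ {P : Set} (p? : Dec P) → P → ⌊ p? ⌋ ≡ true
  true-does p? p = trans (isYes≗does p?) (dec-true p? p)

  module _ {v : ℕ} where

    ==⇒≡ : ∀ {a b : Fin v} → (a == b) ≡ true → a ≡ b
    ==⇒≡ {a} {b} = does-true (a Fin.≟ b)

    ≡⇒== : ∀ {a b : Fin v} → a ≡ b → (a == b) ≡ true
    ≡⇒== {a} {b} = true-does (a Fin.≟ b)

    data PairEq (a b : Fin v) : Fin v → Fin v → Set where
      same-order : PairEq a b a b
      swapped    : PairEq a b b a

    PairEq-cases : ∀ {a b c d : Fin v} → PairEq a b c d → (a ≡ c × b ≡ d) ⊎ (a ≡ d × b ≡ c)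
    PairEq-cases same-order = inj₁ (refl , refl)
    PairEq-cases swapped = inj₂ (refl , refl)

    samePair⇒PairEq : ∀ {a b c d : Fin v} → samePair a b c d ≡ true → PairEq a b c d
    samePair⇒PairEq {a} {b} {c} {d} h with ∨-true ((a == c) ∧ (b == d)) _ h
    ... | inj₁ h₁ with ∧-true (a == c) (b == d) h₁
    ...   | a=c , b=d with ==⇒≡ a=c | ==⇒≡ b=d
    ...     | refl | refl = same-order
    samePair⇒PairEq {a} {b} {c} {d} h | inj₂ h₂ with ∧-true (a == d) (b == c) h₂
    ...   | a=d , b=c with ==⇒≡ a=d | ==⇒≡ b=c
    ...     | refl | refl = swapped

    PairEq⇒samePair : ∀ {a b c d : Fin v} → PairEq a b c d → samePair a b c d ≡ true
    PairEq⇒samePair {a} {b} same-order rewrite ≡⇒== {a = a} refl | ≡⇒== {a = b} refl = refl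
    PairEq⇒samePair {a} {b} swapped rewrite ≡⇒== {a = a} refl | ≡⇒== {a = b} refl =
      ∨-comm ((a == b) ∧ (b == a)) true

    distinct-pairs : ∀ {a b c d : Fin v} → (PairEq a b c d → ⊥) → T (not (samePair a b c d))
    distinct-pairs {a} {b} {c} {d} ¬eq with samePair a b c d in h
    ... | false = tt
    ... | true = ¬eq (samePair⇒PairEq h)

    PairEq-sym : ∀ {a b c d : Fin v} → PairEq a b c d → PairEq c d a b
    PairEq-sym same-order = same-order
    PairEq-sym swapped = swapped

    PairEq-trans : ∀ {a b c d e f : Fin v} → PairEq a b c d → PairEq c d e f → PairEq a b e f
    PairEq-trans same-order q = q
    PairEq-trans swapped same-order = swapped
    PairEq-trans swapped swapped = same-order

  module _ {v d : ℕ} where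

    ==M⇒≡ : ∀ (f g : Mon v d) → (f ==M g) ≡ true → proj₁ f ≡ proj₁ g
    ==M⇒≡ f g = does-true (VecP.≡-dec Nat._≟_ (proj₁ f) (proj₁ g))

    ≡⇒==M : ∀ (f g : Mon v d) → proj₁ f ≡ proj₁ g → (f ==M g) ≡ true
    ≡⇒==M f g = true-does (VecP.≡-dec Nat._≟_ (proj₁ f) (proj₁ g))

-- F₂-formal sums over a set with a Boolean equivalence `same`: the coefficient of e in x is
-- the parity of the number of terms of x equivalent to e.
module FormalSums {A : Set} (same : A → A → Bool)
  (same-refl : ∀ e → same e e ≡ true)
  (same-sym : ∀ e d → same e d ≡ true → same d e ≡ true)
  (same-trans : ∀ a b c → same a b ≡ true → same b c ≡ true → same a c ≡ true) where

  open Parity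

  coeff : List A → A → Bool
  coeff x e = parity (same e) x

  _≈_ : List A → List A → Set
  x ≈ y = ∀ e → coeff x e ≡ coeff y e

  Respects : (A → Bool) → Set
  Respects r = ∀ e d → same e d ≡ true → r e ≡ r d

  same-respects : ∀ x → Respects (λ e → same x e)
  same-respects x e d ed = bool-ext (λ xe → same-trans x e d xe ed) (λ xd → same-trans x d e xd (same-sym e d ed))

  same-respects′ : ∀ x → Respects (λ e → same e x)
  same-respects′ x e d ed = bool-ext (λ ex → same-trans d e x (same-sym e d ed) ex) (λ dx → same-trans e d x ed dx)

  coeff-++ : ∀ x y e → coeff (x ++ y) e ≡ coeff x e xor coeff y e
  coeff-++ x y e = parity-++ (same e) x y

  coeff-respects : ∀ x → Respects (coeff x)
  coeff-respects x e d ed = parity-cong (same e) (same d) x (λ y _ → same-respects′ y e d ed)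

  -- a class-respecting functional vanishes on every sum whose coefficients all vanish:
  -- the terms of such a sum cancel in equivalent pairs
  functional-zero : ∀ r → Respects r → ∀ z → (∀ e → coeff z e ≡ false) → parity r z ≡ false
  functional-zero r resp z = go z (<-wellFounded (length z))
    where
      go : ∀ z → Acc _<_ (length z) → (∀ e → coeff z e ≡ false) → parity r z ≡ false
      go [] _ _ = refl
      go (e ∷ z) (acc smaller) h with parity-split (same e) z partner-exists
        where
          partner-exists : coeff z e ≡ true
          partner-exists = not-false (trans (cong (_xor coeff z e) (sym (same-refl e))) (h e))
      ... | u , w , d , refl , ed = begin
          r e xor parity r (u ++ d ∷ w)        ≡⟨ cong (r e xor_) (parity-++ r u (d ∷ w)) ⟩
          r e xor (parity r u xor (r d xor parity r w))
            ≡⟨ cong (λ t → r e xor (parity r u xor (t xor parity r w))) (sym (resp e d ed)) ⟩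
          r e xor (parity r u xor (r e xor parity r w))
            ≡⟨ solve 3 (λ a b c → a :+ (b :+ (a :+ c)) := b :+ c) refl (r e) (parity r u) (parity r w) ⟩
          parity r u xor parity r w           ≡⟨ sym (parity-++ r u w) ⟩
          parity r (u ++ w)                   ≡⟨ go (u ++ w) (smaller shorter) remaining-zero ⟩
          false ∎
        where
          open ≡-Reasoning
          open xor-∧-Solver
          shorter : length (u ++ w) < length (e ∷ u ++ d ∷ w)
          shorter rewrite length-++ u {w} | length-++ u {d ∷ w} = s≤s (+-monoʳ-≤ (length u) (n≤1+n (length w)))
          remaining-zero : ∀ x → coeff (u ++ w) x ≡ false
          remaining-zero x = begin
            coeff (u ++ w) x                                         ≡⟨ coeff-++ u w x ⟩
            coeff u x xor coeff w x
              ≡⟨ solve 3 (λ a b c → b :+ c := a :+ (b :+ (a :+ c))) refl (same x e) (coeff u x) (coeff w x) ⟩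
            same x e xor (coeff u x xor (same x e xor coeff w x))
              ≡⟨ cong (λ t → same x e xor (coeff u x xor (t xor coeff w x))) (same-respects x e d ed) ⟩
            same x e xor (coeff u x xor (same x d xor coeff w x))   ≡⟨ cong (same x e xor_) (sym (coeff-++ u (d ∷ w) x)) ⟩
            coeff (e ∷ u ++ d ∷ w) x                                 ≡⟨ h x ⟩
            false ∎

  single-≈ : ∀ e d → same e d ≡ true → (e ∷ []) ≈ (d ∷ [])
  single-≈ e d ed x = cong (_xor false) (same-respects x e d ed)

  cancel-pair : ∀ t x y → x ≈ y → (t ∷ []) ≈ ((t ∷ x) ++ y)
  cancel-pair t x y x≈y d = begin
    same d t xor false                        ≡⟨ cong (same d t xor_) (sym (xor-same (coeff y d))) ⟩
    same d t xor (coeff y d xor coeff y d)    ≡⟨ cong (λ c → same d t xor (c xor coeff y d)) (sym (x≈y d)) ⟩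
    same d t xor (coeff x d xor coeff y d)    ≡⟨ cong (same d t xor_) (sym (coeff-++ x y d)) ⟩
    coeff ((t ∷ x) ++ y) d ∎
    where open ≡-Reasoning

  functional-≈ : ∀ r → Respects r → ∀ x y → x ≈ y → parity r x ≡ parity r y
  functional-≈ r resp x y x≈y = xor-false⇒≡ (trans (sym (parity-++ r x y)) (functional-zero r resp (x ++ y) cancel))
    where
      xor-false⇒≡ : ∀ {a b} → a xor b ≡ false → a ≡ b
      xor-false⇒≡ {false} {false} _ = refl
      xor-false⇒≡ {true}  {true}  _ = refl
      cancel : ∀ e → coeff (x ++ y) e ≡ false
      cancel e rewrite coeff-++ x y e | x≈y e = xor-same (coeff y e)

  functional-support : ∀ r → Respects r → ∀ z → (∀ x → x ∈ z → coeff z x ≡ true → r x ≡ false) → parity r z ≡ false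
  functional-support r resp z h = begin
    parity r z        ≡⟨ sym (functional-≈ r resp support z support≈z) ⟩
    parity r support  ≡⟨ parity-false r support (λ x x∈ → let x∈z , odd = ∈-filter⁻ (λ y → T? (coeff z y)) {xs = z} x∈
                                                           in h x x∈z (T⇒≡true odd)) ⟩
    false ∎
    where
      open ≡-Reasoning
      support : List A
      support = filterᵇ (coeff z) z
      support≈z : support ≈ z
      support≈z d = begin
        parity (same d) support                       ≡⟨ parity-filter (same d) (coeff z) z ⟩
        parity (λ x → same d x ∧ coeff z x) z          ≡⟨ parity-cong _ _ z (λ x _ → class-constant x) ⟩
        parity (λ x → same d x ∧ coeff z d) z          ≡⟨ parity-∧ʳ (same d) (coeff z d) z ⟩
        coeff z d ∧ coeff z d                          ≡⟨ ∧-idem (coeff z d) ⟩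
        coeff z d ∎
        where
          class-constant : ∀ x → (same d x ∧ coeff z x) ≡ (same d x ∧ coeff z d)
          class-constant x with same d x in dx
          ... | false = refl
          ... | true = sym (coeff-respects z d x dx)

-- The edge space of G^(k): an edge ag—bg is identified with bg—ag, so edges are compared as
-- unordered pairs together with their monomial.
module Edges {v : ℕ} (G : SimpleGraph v) (k : ℕ) where
  open EqualityTests

  SameEdge : EdgeK G k → EdgeK G k → Set
  SameEdge e d = PairEq (src e) (tgt e) (src d) (tgt d) × proj₁ (mon e) ≡ proj₁ (mon d)

  same⇒SameEdge : ∀ e d → sameEdgeK G k e d ≡ true → SameEdge e d
  same⇒SameEdge e d h =
    let pair , monomial = ∧-true (samePair (src e) (tgt e) (src d) (tgt d)) (mon e ==M mon d) h
    in samePair⇒PairEq pair , ==M⇒≡ (mon e) (mon d) monomial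

  SameEdge⇒same : ∀ e d → SameEdge e d → sameEdgeK G k e d ≡ true
  SameEdge⇒same e d (pair , monomial) rewrite PairEq⇒samePair pair = ≡⇒==M (mon e) (mon d) monomial

  same-refl : ∀ e → sameEdgeK G k e e ≡ true
  same-refl e = SameEdge⇒same e e (same-order , refl)

  same-sym : ∀ e d → sameEdgeK G k e d ≡ true → sameEdgeK G k d e ≡ true
  same-sym e d h = let pair , monomial = same⇒SameEdge e d h in SameEdge⇒same d e (PairEq-sym pair , sym monomial)

  same-trans : ∀ a b c → sameEdgeK G k a b ≡ true → sameEdgeK G k b c ≡ true → sameEdgeK G k a c ≡ true
  same-trans a b c h h' = let p , m = same⇒SameEdge a b h ; p' , m' = same⇒SameEdge b c h' in
    SameEdge⇒same a c (PairEq-trans p p' , trans m m')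

  open FormalSums (sameEdgeK G k) same-refl same-sym same-trans public

module Squares {v : ℕ} (G : SimpleGraph v) (k' : ℕ) where
  open Monomials
  open EqualityTests
  open Parity

  K : ℕ
  K = suc (suc k')

  hk : 2 ≤ K
  hk = s≤s (s≤s z≤n)

  open Edges G K public

  endpoints : EdgeK G K → List (Mon v K)
  endpoints e = mulVar (src e) (mon e) ∷ mulVar (tgt e) (mon e) ∷ []

  -- value at the vertex w of the boundary of an edge
  incident : Mon v K → EdgeK G K → Bool
  incident w e = parity (w ==M_) (endpoints e)

  -- value at the edge ab of G of the projection p* of an edge
  onPair : Fin v → Fin v → EdgeK G K → Bool
  onPair a b e = samePair a b (src e) (tgt e)

  InCycles : EK G K → Set
  InCycles x = ∀ w → parity (incident w) x ≡ false

  InKerP : EK G K → Set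
  InKerP x = ∀ a b → parity (onPair a b) x ≡ false

  ==M-cong : ∀ {d} (w f g : Mon v d) → proj₁ f ≡ proj₁ g → (w ==M f) ≡ (w ==M g)
  ==M-cong w f g f≡g = bool-ext (λ h → ≡⇒==M w g (trans (==M⇒≡ w f h) f≡g))
                                (λ h → ≡⇒==M w f (trans (==M⇒≡ w g h) (sym f≡g)))

  incident-monomial : ∀ w a b ab ab' g g' → proj₁ g ≡ proj₁ g' →
    incident w (edgeK a b ab g) ≡ incident w (edgeK a b ab' g')
  incident-monomial w a b ab ab' g g' g≡g' = cong₂ (λ s t → s xor (t xor false))
    (==M-cong w (mulVar a g) (mulVar a g') (cong (_*ˣ a) g≡g'))
    (==M-cong w (mulVar b g) (mulVar b g') (cong (_*ˣ b) g≡g'))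

  incident-swap : ∀ w a b ab ba g → incident w (edgeK a b ab g) ≡ incident w (edgeK b a ba g)
  incident-swap w a b ab ba g = swap (w ==M mulVar a g) (w ==M mulVar b g)
    where
      open xor-∧-Solver
      swap : ∀ s t → s xor (t xor false) ≡ t xor (s xor false)
      swap = solve 2 (λ s t → s :+ (t :+ con false) := t :+ (s :+ con false)) refl

  incident-respects : ∀ w → Respects (incident w)
  incident-respects w e@(edgeK a b ab g) d@(edgeK _ _ ab' g') ed with same⇒SameEdge e d ed
  ... | same-order , g≡g' = incident-monomial w a b ab ab' g g' g≡g'
  ... | swapped , g≡g' = trans (incident-monomial w a b ab ab-from-ba g g' g≡g') (incident-swap w a b ab-from-ba ab' g')
    where
      ab-from-ba : Adj G a b
      ab-from-ba = subst T (SimpleGraph.sym G b a) ab'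

  onPair-respects : ∀ a b → Respects (onPair a b)
  onPair-respects a b e d ed = bool-ext
    (λ h → PairEq⇒samePair (PairEq-trans (samePair⇒PairEq {a = a} {b} h) (proj₁ (same⇒SameEdge e d ed))))
    (λ h → PairEq⇒samePair (PairEq-trans (samePair⇒PairEq {a = a} {b} h) (PairEq-sym (proj₁ (same⇒SameEdge e d ed)))))

  -- the eight endpoints of a square cancel in pairs
  square-boundary : ∀ w a b c d ab cd f → parity (incident w) (square G K hk a b c d ab cd f) ≡ false
  square-boundary w a b c d ab cd f
    rewrite *ˣ-comm (proj₁ f) b c | *ˣ-comm (proj₁ f) b d | *ˣ-comm (proj₁ f) a c | *ˣ-comm (proj₁ f) a d =
    cancel-in-pairs (w ==M mulVar a (mulVar c f)) (w ==M mulVar b (mulVar c f))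
                    (w ==M mulVar b (mulVar d f)) (w ==M mulVar a (mulVar d f))
    where
      open xor-∧-Solver
      cancel-in-pairs : ∀ A B D X → (A xor (B xor false)) xor ((B xor (D xor false)) xor ((X xor (D xor false))
                                      xor ((A xor (X xor false)) xor false))) ≡ false
      cancel-in-pairs = solve 4 (λ A B D X → (A :+ (B :+ con false)) :+ ((B :+ (D :+ con false)) :+ ((X :+ (D :+ con false))
                          :+ ((A :+ (X :+ con false)) :+ con false))) := con false) refl

  -- each of the edges ab, cd of G is hit twice
  square-projection : ∀ p q a b c d ab cd f → parity (onPair p q) (square G K hk a b c d ab cd f) ≡ false
  square-projection p q a b c d ab cd f =
    solve 2 (λ s t → s :+ (t :+ (s :+ (t :+ con false))) := con false) refl (samePair p q a b) (samePair p q c d)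
    where open xor-∧-Solver

  squareSum : List (SquareIndex G K) → EK G K
  squareSum l = concat (map (squareOf G K hk) l)

  squareSum-cycles : ∀ l → InCycles (squareSum l)
  squareSum-cycles l w = trans (parity-concatMap (incident w) (squareOf G K hk) l)
    (parity-false _ l (λ { (sqIdx a b c d ab cd _ f) _ → square-boundary w a b c d ab cd f }))

  squareSum-kerP : ∀ l → InKerP (squareSum l)
  squareSum-kerP l p q = trans (parity-concatMap (onPair p q) (squareOf G K hk) l)
    (parity-false _ l (λ { (sqIdx a b c d ab cd _ f) _ → square-projection p q a b c d ab cd f }))

  InCycles-≈ : ∀ x y → x ≈ y → InCycles x → InCycles y
  InCycles-≈ x y x≈y cx w = trans (sym (functional-≈ (incident w) (incident-respects w) x y x≈y)) (cx w)

  InKerP-≈ : ∀ x y → x ≈ y → InKerP x → InKerP y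
  InKerP-≈ x y x≈y kx a b = trans (sym (functional-≈ (onPair a b) (onPair-respects a b) x y x≈y)) (kx a b)

  cycleSpace⇔ : ∀ x → InCycleSpace G K (s≤s z≤n) x ⇔ InCycles x
  cycleSpace⇔ x = mk⇔ (λ c w → trans (sym (boundary-at w)) (c w)) (λ c w → trans (boundary-at w) (c w))
    where
      boundary-at : ∀ w → parity (w ==M_) (boundary G K (s≤s z≤n) x) ≡ parity (incident w) x
      boundary-at w = parity-concatMap (w ==M_) endpoints x

  kerP⇔ : ∀ x → _≈G_ G K (pStar G K x) [] ⇔ InKerP x
  kerP⇔ x = mk⇔ to (λ k e → trans (projection-at e) (k (srcG e) (tgtG e)))
    where
      projection-at : ∀ (e : EdgeG G K) → parity (λ e' → samePair (srcG e) (tgtG e) (srcG e') (tgtG e')) (pStar G K x)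
                                          ≡ parity (onPair (srcG e) (tgtG e)) x
      projection-at e = parity-map _ _ x
      -- a pair that is not an edge of G is never hit
      to : _≈G_ G K (pStar G K x) [] → InKerP x
      to h a b with adj G a b in ab
      ... | true = let e = edgeG a b (subst T (sym ab) tt) in trans (sym (projection-at e)) (h e)
      ... | false = parity-false _ x non-edge
        where
          non-edge : ∀ e → e ∈ x → onPair a b e ≡ false
          non-edge e _ with onPair a b e in hit
          ... | false = refl
          ... | true with samePair⇒PairEq {a = a} {b} {src e} {tgt e} hit
          ...   | same-order = ⊥-elim (subst T ab (isAdj e))
          ...   | swapped = ⊥-elim (subst T (trans (SimpleGraph.sym G b a) ab) (isAdj e))

  squareSpace⊆ : ∀ x → InSquareSpace G K hk x → InCycles x × InKerP x
  squareSpace⊆ x (l , l≈x) =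
    InCycles-≈ (squareSum l) x l≈x (squareSum-cycles l) , InKerP-≈ (squareSum l) x l≈x (squareSum-kerP l)

module Tree {n : ℕ} (G : SimpleGraph (suc n)) (Tr : BFSTree G) where
  open EqualityTests

  p : Fin (suc n) → Fin (suc n)
  p = parent Tr

  -- the breadth-first labelling puts the parent (one level closer to the root) first
  parent-< : ∀ j → 0 < toℕ j → toℕ (p j) < toℕ j
  parent-< j j0 = ≰⇒> λ j≤pj →
    <-irrefl refl (subst (_≤ depth Tr (p j)) (depth-parent Tr j j0) (labelling Tr j (p j) j≤pj))

  nonroot : ∀ (j : Fin (suc n)) → 0 < toℕ j → isNonRoot j ≡ true
  nonroot (suc j) _ = refl

  nonroot⁻ : ∀ (j : Fin (suc n)) → isNonRoot j ≡ true → 0 < toℕ j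
  nonroot⁻ (suc j) _ = s≤s z≤n

  treeEdge : ∀ {a b} j → 0 < toℕ j → PairEq a b j (p j) → isTreeEdge Tr a b ≡ true
  treeEdge {b = b} j j0 same-order =
    trans (cong (isNonRoot b ∧ (p b == j) ∨_) (cong₂ _∧_ (nonroot j j0) (≡⇒== {a = p j} refl))) (∨-zeroʳ _)
  treeEdge {a} j j0 swapped = cong₂ (λ s t → s ∧ t ∨ (isNonRoot a ∧ (p a == j))) (nonroot j j0) (≡⇒== {a = p j} refl)

  treeEdge-classify : ∀ a b → isTreeEdge Tr a b ≡ true → (0 < toℕ b × p b ≡ a) ⊎ (0 < toℕ a × p a ≡ b)
  treeEdge-classify a b h with ∨-true (isNonRoot b ∧ (p b == a)) (isNonRoot a ∧ (p a == b)) h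
  ... | inj₁ hb = let nr , eq = ∧-true (isNonRoot b) (p b == a) hb in inj₁ (nonroot⁻ b nr , ==⇒≡ eq)
  ... | inj₂ ha = let nr , eq = ∧-true (isNonRoot a) (p a == b) ha in inj₂ (nonroot⁻ a nr , ==⇒≡ eq)

  treeEdge-sym : ∀ a b → isTreeEdge Tr a b ≡ isTreeEdge Tr b a
  treeEdge-sym a b = ∨-comm (isNonRoot b ∧ (p b == a)) (isNonRoot a ∧ (p a == b))

  nonTree≢treeEdge : ∀ ℓ m j → 0 < toℕ j → T (not (isTreeEdge Tr ℓ m)) → PairEq ℓ m j (p j) → ⊥
  nonTree≢treeEdge ℓ m j j0 nt eq = subst (λ b → T (not b)) (treeEdge j j0 eq) nt

  treeEdges-distinct : ∀ i j → 0 < toℕ i → toℕ i < toℕ j → PairEq i (p i) j (p j) → ⊥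
  treeEdges-distinct i j i0 i<j eq with PairEq-cases eq
  ... | inj₁ (refl , _) = <-irrefl refl i<j
  ... | inj₂ (i≡pj , pi≡j) = <-irrefl refl (<-trans i<j (subst (λ z → toℕ z < toℕ i) pi≡j (parent-< i i0)))

module Family {n : ℕ} (G : SimpleGraph (suc n)) (Tr : BFSTree G) (k' : ℕ) where
  open Squares G k' public
  open Tree G Tr public
  open EqualityTests

  Index : Set
  Index = UpsilonIndex G Tr K ⊎ OmegaIndex G Tr K

  B : Index → EK G K
  B = 𝓑 G Tr K hk

  span : List Index → EK G K
  span L = concat (map B L)

  treeEdgeK : ∀ i → 0 < toℕ i → Mon (suc n) (suc k') → EdgeK G K
  treeEdgeK i i0 g = edgeK i (p i) (parent-adj Tr i i0) g

  leading : Index → EdgeK G K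
  leading (inj₁ (υ i j i0 _ f _)) = treeEdgeK i i0 (mulVar j f)
  leading (inj₂ (ω ℓ m _ ℓm _ j _ f _)) = edgeK ℓ m ℓm (mulVar j f)

  trailing : Index → EK G K
  trailing (inj₁ (υ i j i0 i<j f _)) =
    treeEdgeK j (<-trans i0 i<j) (mulVar (p i) f) ∷ treeEdgeK i i0 (mulVar (p j) f)
      ∷ treeEdgeK j (<-trans i0 i<j) (mulVar i f) ∷ []
  trailing (inj₂ (ω ℓ m _ ℓm _ j j0 f _)) =
    treeEdgeK j j0 (mulVar m f) ∷ edgeK ℓ m ℓm (mulVar (p j) f) ∷ treeEdgeK j j0 (mulVar ℓ f) ∷ []

  B-split : ∀ idx → B idx ≡ leading idx ∷ trailing idx
  B-split (inj₁ _) = refl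
  B-split (inj₂ _) = refl

  toSquareIndex : Index → SquareIndex G K
  toSquareIndex (inj₁ (υ i j i0 i<j f _)) =
    sqIdx i (p i) j (p j) (parent-adj Tr i i0) (parent-adj Tr j (<-trans i0 i<j))
          (distinct-pairs (treeEdges-distinct i j i0 i<j)) f
  toSquareIndex (inj₂ (ω ℓ m _ ℓm nt j j0 f _)) =
    sqIdx ℓ m j (p j) ℓm (parent-adj Tr j j0) (distinct-pairs (nonTree≢treeEdge ℓ m j j0 nt)) f

  span≡squareSum : ∀ L → span L ≡ squareSum (map toSquareIndex L)
  span≡squareSum [] = refl
  span≡squareSum (inj₁ i ∷ L) = cong (B (inj₁ i) ++_) (span≡squareSum L)
  span≡squareSum (inj₂ i ∷ L) = cong (B (inj₂ i) ++_) (span≡squareSum L)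

  span-cycles : ∀ L → InCycles (span L)
  span-cycles L rewrite span≡squareSum L = squareSum-cycles (map toSquareIndex L)

  span-kerP : ∀ L → InKerP (span L)
  span-kerP L rewrite span≡squareSum L = squareSum-kerP (map toSquareIndex L)

  span-++ : ∀ L L' → span (L ++ L') ≡ span L ++ span L'
  span-++ [] L' = refl
  span-++ (i ∷ L) L' = trans (cong (B i ++_) (span-++ L L')) (sym (++-assoc (B i) (span L) (span L')))

-- A non-canonical
-- edge is the leading term of a member of ℬ whose other terms are canonical or of smaller weight.
module Reduction {n : ℕ} (G : SimpleGraph (suc n)) (Tr : BFSTree G) (k' : ℕ) where
  open Family G Tr k'
  open Monomials
  open EqualityTests

  Mon₁ : Set
  Mon₁ = Mon (suc n) (suc k')

  CanonicalTree : EdgeK G K → Set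
  CanonicalTree e = Σ (Fin (suc n)) λ i → Σ (0 < toℕ i) λ i0 → Σ Mon₁ λ g →
    e ≡ treeEdgeK i i0 g × Supported i (proj₁ g)

  CanonicalNonTree : EdgeK G K → Set
  CanonicalNonTree e = Σ (Fin (suc n)) λ ℓ → Σ (Fin (suc n)) λ m → Σ (Adj G ℓ m) λ ℓm →
    T (not (isTreeEdge Tr ℓ m)) × Σ Mon₁ λ g → e ≡ edgeK ℓ m ℓm g × Supported zero (proj₁ g)

  Canonical : EdgeK G K → Set
  Canonical e = CanonicalTree e ⊎ CanonicalNonTree e

  record Reduces (x : EK G K) : Set where
    constructor reduces
    field
      basisPart : List Index
      rest      : EK G K
      canonical : All Canonical rest
      splits    : x ≈ (span basisPart ++ rest)

  reduces-[] : Reduces []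
  reduces-[] = reduces [] [] [] (λ _ → refl)

  reduces-canonical : ∀ {e} → Canonical e → Reduces (e ∷ [])
  reduces-canonical c = reduces [] _ (c ∷ []) (λ _ → refl)

  reduces-≈ : ∀ {x y} → x ≈ y → Reduces y → Reduces x
  reduces-≈ x≈y (reduces L r c y≈) = reduces L r c (λ d → trans (x≈y d) (y≈ d))

  reduces-++ : ∀ {x y} → Reduces x → Reduces y → Reduces (x ++ y)
  reduces-++ {x} {y} (reduces L r c x≈) (reduces L' r' c' y≈) = reduces (L ++ L') (r ++ r') (++⁺ c c') λ d → begin
    coeff (x ++ y) d                                            ≡⟨ coeff-++ x y d ⟩
    coeff x d xor coeff y d                                     ≡⟨ cong₂ _xor_ (x≈ d) (y≈ d) ⟩
    coeff (span L ++ r) d xor coeff (span L' ++ r') d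
      ≡⟨ cong₂ _xor_ (coeff-++ (span L) r d) (coeff-++ (span L') r' d) ⟩
    (coeff (span L) d xor coeff r d) xor (coeff (span L') d xor coeff r' d)
      ≡⟨ interchange (coeff (span L) d) (coeff r d) (coeff (span L') d) (coeff r' d) ⟩
    (coeff (span L) d xor coeff (span L') d) xor (coeff r d xor coeff r' d)
      ≡⟨ sym (cong₂ _xor_ (coeff-++ (span L) (span L') d) (coeff-++ r r' d)) ⟩
    coeff (span L ++ span L') d xor coeff (r ++ r') d           ≡⟨ cong (λ s → coeff s d xor _) (sym (span-++ L L')) ⟩
    coeff (span (L ++ L')) d xor coeff (r ++ r') d              ≡⟨ sym (coeff-++ (span (L ++ L')) (r ++ r') d) ⟩
    coeff (span (L ++ L') ++ (r ++ r')) d ∎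
    where
      open ≡-Reasoning
      open xor-∧-Solver
      interchange : ∀ a b c d → (a xor b) xor (c xor d) ≡ (a xor c) xor (b xor d)
      interchange = solve 4 (λ a b c d → (a :+ b) :+ (c :+ d) := (a :+ c) :+ (b :+ d)) refl

  reduces-leading : ∀ idx → Reduces (trailing idx) → Reduces (leading idx ∷ [])
  reduces-leading idx (reduces L r c t≈) = reduces (idx ∷ L) r c λ d → begin
    coeff (leading idx ∷ []) d                               ≡⟨ cancel-pair (leading idx) (trailing idx) _ t≈ d ⟩
    coeff ((leading idx ∷ trailing idx) ++ (span L ++ r)) d
      ≡⟨ cong (λ s → coeff s d) (sym (++-assoc (leading idx ∷ trailing idx) (span L) r)) ⟩
    coeff (((leading idx ∷ trailing idx) ++ span L) ++ r) d
      ≡⟨ cong (λ s → coeff ((s ++ span L) ++ r) d) (sym (B-split idx)) ⟩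
    coeff (span (idx ∷ L) ++ r) d ∎
    where open ≡-Reasoning

  monomial-≡ : ∀ {f g : Mon₁} → proj₁ f ≡ proj₁ g → f ≡ g
  monomial-≡ {f0 , deg} {.f0 , deg'} refl = cong (f0 ,_) (≡-irrelevant deg deg')

  beyond : ∀ i j (f : Vec ℕ (suc n)) → Supported j f → vanishesAbove i (f *ˣ j) ≡ false → toℕ i < toℕ j
  beyond i j f f-supp not-supp = ≰⇒> λ j≤i →
    subst T not-supp (supported-*ˣ f (supported-mono f f-supp j≤i) j≤i)

  -- e_i·g: if g ∉ M(a_1, …, a_i), trade it for the other terms of (e_i □ e_j) f where g = f·a_j
  reduce-tree : ∀ i i0 (g : Mon₁) → Acc _<_ (weight (proj₁ g)) → Reduces (treeEdgeK i i0 g ∷ [])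
  reduce-tree i i0 (g0 , deg) (acc smaller) with vanishesAbove i g0 in supp
  ... | true = reduces-canonical (inj₁ (i , i0 , (g0 , deg) , refl , subst T (sym supp) tt))
  ... | false with split-last-variable g0 k' deg
  ...   | j , f0 , deg-f , refl , f-supp =
    subst (λ g → Reduces (treeEdgeK i i0 g ∷ [])) (monomial-≡ refl) (reduces-leading idx trailing-reduces)
    where
      f : Mon (suc n) k'
      f = f0 , deg-f
      i<j : toℕ i < toℕ j
      i<j = beyond i j f0 f-supp supp
      j0 : 0 < toℕ j
      j0 = <-trans i0 i<j
      idx : Index
      idx = inj₁ (υ i j i0 i<j f f-supp)
      trailing-reduces : Reduces (trailing idx)
      trailing-reduces =
        reduces-++ (reduces-canonical (inj₁ (j , j0 , mulVar (p i) f , refl ,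
                                              supported-*ˣ f0 f-supp (<⇒≤ (<-trans (parent-< i i0) i<j)))))
        (reduces-++ (reduce-tree i i0 (mulVar (p j) f) (smaller (weight-*ˣ-< f0 (parent-< j j0))))
        (reduces-++ (reduces-canonical (inj₁ (j , j0 , mulVar i f , refl , supported-*ˣ f0 f-supp (<⇒≤ i<j))))
          reduces-[]))

  -- a_ℓa_m·g: if g ≠ a_1^{k-1}, trade it for the other terms of (a_ℓa_m □ e_j) f where g = f·a_j
  reduce-nonTree : ∀ ℓ m → toℕ ℓ < toℕ m → (ℓm : Adj G ℓ m) → T (not (isTreeEdge Tr ℓ m)) →
    (g : Mon₁) → Acc _<_ (weight (proj₁ g)) → Reduces (edgeK ℓ m ℓm g ∷ [])
  reduce-nonTree ℓ m ℓ<m ℓm nt (g0 , deg) (acc smaller) with vanishesAbove zero g0 in supp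
  ... | true = reduces-canonical (inj₂ (ℓ , m , ℓm , nt , (g0 , deg) , refl , subst T (sym supp) tt))
  ... | false with split-last-variable g0 k' deg
  ...   | j , f0 , deg-f , refl , f-supp =
    subst (λ g → Reduces (edgeK ℓ m ℓm g ∷ [])) (monomial-≡ refl) (reduces-leading idx trailing-reduces)
    where
      f : Mon (suc n) k'
      f = f0 , deg-f
      j0 : 0 < toℕ j
      j0 = beyond zero j f0 f-supp supp
      idx : Index
      idx = inj₂ (ω ℓ m ℓ<m ℓm nt j j0 f f-supp)
      trailing-reduces : Reduces (trailing idx)
      trailing-reduces =
        reduces-++ (reduce-tree j j0 (mulVar m f) (<-wellFounded _))
        (reduces-++ (reduce-nonTree ℓ m ℓ<m ℓm nt (mulVar (p j) f) (smaller (weight-*ˣ-< f0 (parent-< j j0))))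
        (reduces-++ (reduce-tree j j0 (mulVar ℓ f) (<-wellFounded _))
          reduces-[]))

  reduce-edge : ∀ e → Reduces (e ∷ [])
  reduce-edge e@(edgeK a b ab g) with isTreeEdge Tr a b in tree
  ... | true with treeEdge-classify a b tree
  ...   | inj₁ (b0 , refl) = let t = treeEdgeK b b0 g in
    reduces-≈ (single-≈ e t (SameEdge⇒same e t (swapped , refl))) (reduce-tree b b0 g (<-wellFounded _))
  ...   | inj₂ (a0 , refl) = let t = treeEdgeK a a0 g in
    reduces-≈ (single-≈ e t (SameEdge⇒same e t (same-order , refl))) (reduce-tree a a0 g (<-wellFounded _))
  reduce-edge e@(edgeK a b ab g) | false with <-cmp (toℕ a) (toℕ b)
  ... | tri< a<b _ _ = reduce-nonTree a b a<b ab (subst (λ t → T (not t)) (sym tree) tt) g (<-wellFounded _)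
  ... | tri≈ _ a≡b _ with toℕ-injective a≡b
  ...   | refl = ⊥-elim (subst T (irrefl G a) ab)
  reduce-edge e@(edgeK a b ab g) | false | tri> _ _ b<a =
    reduces-≈ (single-≈ e (edgeK b a ba g) (SameEdge⇒same e (edgeK b a ba g) (swapped , refl)))
      (reduce-nonTree b a b<a ba (subst (λ t → T (not t)) (sym (trans (treeEdge-sym b a) tree)) tt) g (<-wellFounded _))
    where
      ba : Adj G b a
      ba = subst T (SimpleGraph.sym G a b) ab

  reduce : ∀ x → Reduces x
  reduce [] = reduces-[]
  reduce (e ∷ x) = reduces-++ (reduce-edge e) (reduce x)

-- Non-tree canonical edges are detected by p*, as a_ℓa_m·a_1^{k-1} is the only canonical edge over
-- a_ℓa_m.  Among the remaining tree edges e_i·g, one with (i, exponent of a_i in g) maximal is the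
-- only term meeting the vertex a_i·g, so the boundary would not vanish there.
module Rigidity {n : ℕ} (G : SimpleGraph (suc n)) (Tr : BFSTree G) (k' : ℕ) where
  open Family G Tr k'
  open Reduction G Tr k'
  open Monomials
  open EqualityTests
  open Parity
  open Lex

  onPair-canonical : ∀ ℓ m ℓm → T (not (isTreeEdge Tr ℓ m)) → ∀ g → Supported zero (proj₁ g) →
    ∀ x → Canonical x → onPair ℓ m x ≡ sameEdgeK G K (edgeK ℓ m ℓm g) x
  onPair-canonical ℓ m ℓm nt g _ x (inj₁ (i , i0 , h , refl , _))
    rewrite T-not⇒≡false (distinct-pairs (nonTree≢treeEdge ℓ m i i0 nt)) = refl
  onPair-canonical ℓ m ℓm nt g g-root x (inj₂ (ℓ' , m' , _ , _ , h , refl , h-root))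
    rewrite ≡⇒==M g h (supported-root-unique (proj₁ g) (proj₁ h) g-root h-root (trans (proj₂ g) (sym (proj₂ h)))) =
    sym (∧-identityʳ (samePair ℓ m ℓ' m'))

  nonTree-coeff : ∀ c → All Canonical c → InKerP c → ∀ e → CanonicalNonTree e → coeff c e ≡ false
  nonTree-coeff c can ker e (ℓ , m , ℓm , nt , g , refl , g-root) =
    trans (sym (parity-cong _ _ c (λ x x∈ → onPair-canonical ℓ m ℓm nt g g-root x (All.lookup can x∈)))) (ker ℓ m)

  support-tree : ∀ c → All Canonical c → InKerP c → ∀ x → x ∈ c → coeff c x ≡ true → CanonicalTree x
  support-tree c can ker x x∈ odd with All.lookup can x∈
  ... | inj₁ ct = ct
  ... | inj₂ cn = ⊥-elim (true≢false (trans (sym odd) (nonTree-coeff c can ker x cn)))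

  key : EdgeK G K → ℕ × ℕ
  key x = toℕ (src x) , lookup (proj₁ (mon x)) (src x)

  ==M-at : ∀ {d} (f g : Mon (suc n) d) t → lookup (proj₁ f) t ≢ lookup (proj₁ g) t → (f ==M g) ≡ false
  ==M-at f g t differ with f ==M g in fg
  ... | false = refl
  ... | true = ⊥-elim (differ (cong (λ u → lookup u t) (==M⇒≡ f g fg)))

  ==M-mulVar : ∀ {d} a (f g : Mon (suc n) d) → (mulVar a f ==M mulVar a g) ≡ (f ==M g)
  ==M-mulVar a f g = bool-ext
    (λ h → ≡⇒==M f g (*ˣ-cancel (proj₁ f) (proj₁ g) a (==M⇒≡ (mulVar a f) (mulVar a g) h)))
    (λ h → ≡⇒==M (mulVar a f) (mulVar a g) (cong (_*ˣ a) (==M⇒≡ f g h)))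

  top-vertex-meets : ∀ i i0 g i' i0' h → Supported i' (proj₁ h) → key (treeEdgeK i' i0' h) ≤ₗ key (treeEdgeK i i0 g) →
    incident (mulVar i g) (treeEdgeK i' i0' h) ≡ sameEdgeK G K (treeEdgeK i i0 g) (treeEdgeK i' i0' h)
  top-vertex-meets i i0 g i' i0' h h-supp (inj₁ i'<i) =
    trans (cong₂ (λ s t → s xor (t xor false))
                 (==M-at (mulVar i g) (mulVar i' h) i (missing i' (≢-sym (<⇒≢ i'<i))))
                 (==M-at (mulVar i g) (mulVar (p i') h) i (missing (p i') (≢-sym (<⇒≢ (<-trans (parent-< i' i0') i'<i))))))
          (sym (cong (_∧ (g ==M h)) (T-not⇒≡false (distinct-pairs {a = i} {p i} {i'} {p i'} lower))))
    where
      -- a_i divides a_i·g but neither endpoint of e_{i'}·h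
      missing : ∀ t → i ≢ t → lookup (proj₁ g *ˣ i) i ≢ lookup (proj₁ h *ˣ t) i
      missing t i≢t eq = suc≢zero (begin
        suc (lookup (proj₁ g) i)  ≡⟨ sym (lookup-*ˣ-same (proj₁ g) i) ⟩
        lookup (proj₁ g *ˣ i) i   ≡⟨ eq ⟩
        lookup (proj₁ h *ˣ t) i   ≡⟨ lookup-*ˣ-other (proj₁ h) i≢t ⟩
        lookup (proj₁ h) i        ≡⟨ supported⇒zero (proj₁ h) h-supp i i'<i ⟩
        0 ∎)
        where open ≡-Reasoning
      lower : PairEq i (p i) i' (p i') → ⊥
      lower eq with PairEq-cases eq
      ... | inj₁ (refl , _) = <-irrefl refl i'<i
      ... | inj₂ (i≡pi' , _) = <-irrefl refl (<-trans (subst (λ z → toℕ z < toℕ i') (sym i≡pi') (parent-< i' i0')) i'<i)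
  top-vertex-meets i i0 g i' i0' h h-supp (inj₂ (i'≡i , h≤g)) with toℕ-injective i'≡i
  ... | refl = begin
    (mulVar i g ==M mulVar i h) xor ((mulVar i g ==M mulVar (p i) h) xor false)
      ≡⟨ cong₂ (λ s t → s xor (t xor false)) (==M-mulVar i g h) (==M-at (mulVar i g) (mulVar (p i) h) i parent-end) ⟩
    (g ==M h) xor false                            ≡⟨ xor-identityʳ (g ==M h) ⟩
    g ==M h                                        ≡⟨ cong (_∧ (g ==M h)) (sym (PairEq⇒samePair {a = i} {p i} same-order)) ⟩
    samePair i (p i) i (p i) ∧ (g ==M h) ∎
    where
      open ≡-Reasoning
      -- the exponent of a_i in a_{p(i)}·h is at most that in g, hence below that in a_i·g
      parent-end : lookup (proj₁ g *ˣ i) i ≢ lookup (proj₁ h *ˣ p i) i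
      parent-end eq = <-irrefl refl (subst (_≤ lookup (proj₁ g) i) (sym exponents) h≤g)
        where
          exponents : suc (lookup (proj₁ g) i) ≡ lookup (proj₁ h) i
          exponents = begin
            suc (lookup (proj₁ g) i)   ≡⟨ sym (lookup-*ˣ-same (proj₁ g) i) ⟩
            lookup (proj₁ g *ˣ i) i    ≡⟨ eq ⟩
            lookup (proj₁ h *ˣ p i) i  ≡⟨ lookup-*ˣ-other (proj₁ h) (≢-sym (<⇒≢ (parent-< i i0))) ⟩
            lookup (proj₁ h) i ∎

  top-vertex : ∀ c → All Canonical c → InKerP c → ∀ i i0 g → coeff c (treeEdgeK i i0 g) ≡ true →
    (∀ x → x ∈ c → coeff c x ≡ true → key x ≤ₗ key (treeEdgeK i i0 g)) → parity (incident (mulVar i g)) c ≡ true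
  top-vertex c can ker i i0 g top maximal = begin
    parity (incident w) c                          ≡⟨ parity-cong _ _ c (λ x _ → split (incident w x) (same top-edge x)) ⟩
    parity (λ x → same top-edge x xor rest x) c    ≡⟨ parity-xor (same top-edge) rest c ⟩
    coeff c top-edge xor parity rest c             ≡⟨ cong₂ _xor_ top rest-vanishes ⟩
    true ∎
    where
      open ≡-Reasoning
      w : Mon (suc n) K
      w = mulVar i g
      top-edge : EdgeK G K
      top-edge = treeEdgeK i i0 g
      same : EdgeK G K → EdgeK G K → Bool
      same = sameEdgeK G K
      rest : EdgeK G K → Bool
      rest x = incident w x xor same top-edge x
      split : ∀ s t → s ≡ t xor (s xor t)
      split = solve 2 (λ s t → s := t :+ (s :+ t)) refl
        where open xor-∧-Solver
      rest-vanishes : parity rest c ≡ false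
      rest-vanishes = functional-support rest
        (λ x y xy → cong₂ _xor_ (incident-respects w x y xy) (same-respects top-edge x y xy)) c
        λ x x∈ odd → meets x (support-tree c can ker x x∈ odd) (maximal x x∈ odd)
        where
          meets : ∀ x → CanonicalTree x → key x ≤ₗ key top-edge → rest x ≡ false
          meets x (i' , i0' , h , refl , h-supp) below
            rewrite top-vertex-meets i i0 g i' i0' h h-supp below = xor-same (same top-edge x)

  canonical-zero : ∀ c → All Canonical c → InCycles c → InKerP c → ∀ e → coeff c e ≡ false
  canonical-zero c can cyc ker e with coeff c e in ce
  ... | false = refl
  ... | true with parity-true (sameEdgeK G K e) c ce
  ...   | d , d∈c , ed with maximum key support (∈-filter⁺ (λ x → T? (coeff c x)) d∈c d-odd)
    where
      support : EK G K
      support = filterᵇ (coeff c) c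
      d-odd : T (coeff c d)
      d-odd = subst T (sym (trans (sym (coeff-respects c e d ed)) ce)) tt
  ...     | top , top∈ , top-max with ∈-filter⁻ (λ x → T? (coeff c x)) {xs = c} top∈
  ...       | top∈c , top-odd with support-tree c can ker top top∈c (T⇒≡true top-odd)
  ...         | i , i0 , g , refl , _ =
    ⊥-elim (true≢false (trans (sym (top-vertex c can ker i i0 g (T⇒≡true top-odd) maximal)) (cyc (mulVar i g))))
    where
      maximal : ∀ x → x ∈ c → coeff c x ≡ true → key x ≤ₗ key (treeEdgeK i i0 g)
      maximal x x∈ odd = All.lookup top-max (∈-filter⁺ (λ y → T? (coeff c y)) x∈ (subst T (sym odd) tt))

-- The leading term of a member of ℬ outranks its other three terms and
-- determines the member, so in a sum of distinct members the top-ranked leading term survives.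
module Independence {n : ℕ} (G : SimpleGraph (suc n)) (Tr : BFSTree G) (k' : ℕ) where
  open Family G Tr k'
  open Monomials
  open EqualityTests
  open Parity
  open Lex

  rank : EdgeK G K → ℕ × ℕ
  rank e = (if isTreeEdge Tr (src e) (tgt e) then 0 else 1) , weight (proj₁ (mon e))

  rank-respects : ∀ e d → sameEdgeK G K e d ≡ true → rank e ≡ rank d
  rank-respects e d ed with same⇒SameEdge e d ed
  ... | same-order , g≡g' = cong (_ ,_) (cong weight g≡g')
  ... | swapped , g≡g' = cong₂ _,_ (cong (λ b → if b then 0 else 1) (treeEdge-sym (src e) (tgt e))) (cong weight g≡g')

  tree<tree : ∀ i i0 j j0 g g' → weight (proj₁ g) < weight (proj₁ g') → rank (treeEdgeK i i0 g) <ₗ rank (treeEdgeK j j0 g')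
  tree<tree i i0 j j0 g g' lt rewrite treeEdge i i0 same-order | treeEdge j j0 same-order = inj₂ (refl , lt)

  tree<nonTree : ∀ i i0 ℓ m ℓm g g' → T (not (isTreeEdge Tr ℓ m)) → rank (treeEdgeK i i0 g) <ₗ rank (edgeK ℓ m ℓm g')
  tree<nonTree i i0 ℓ m ℓm g g' nt rewrite treeEdge i i0 same-order | T-not⇒≡false nt = inj₁ (s≤s z≤n)

  nonTree<nonTree : ∀ ℓ m ℓm g g' → weight (proj₁ g) < weight (proj₁ g') → rank (edgeK ℓ m ℓm g) <ₗ rank (edgeK ℓ m ℓm g')
  nonTree<nonTree ℓ m ℓm g g' lt = inj₂ (refl , lt)

  trailing-below : ∀ idx t → t ∈ trailing idx → rank t <ₗ rank (leading idx)
  trailing-below (inj₁ (υ i j i0 i<j f _)) t (here refl) =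
    tree<tree j (<-trans i0 i<j) i i0 (mulVar (p i) f) (mulVar j f) (weight-*ˣ-< (proj₁ f) (<-trans (parent-< i i0) i<j))
  trailing-below (inj₁ (υ i j i0 i<j f _)) t (there (here refl)) =
    tree<tree i i0 i i0 (mulVar (p j) f) (mulVar j f) (weight-*ˣ-< (proj₁ f) (parent-< j (<-trans i0 i<j)))
  trailing-below (inj₁ (υ i j i0 i<j f _)) t (there (there (here refl))) =
    tree<tree j (<-trans i0 i<j) i i0 (mulVar i f) (mulVar j f) (weight-*ˣ-< (proj₁ f) i<j)
  trailing-below (inj₂ (ω ℓ m _ ℓm nt j j0 f _)) t (here refl) =
    tree<nonTree j j0 ℓ m ℓm (mulVar m f) (mulVar j f) nt
  trailing-below (inj₂ (ω ℓ m _ ℓm nt j j0 f _)) t (there (here refl)) =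
    nonTree<nonTree ℓ m ℓm (mulVar (p j) f) (mulVar j f) (weight-*ˣ-< (proj₁ f) (parent-< j j0))
  trailing-below (inj₂ (ω ℓ m _ ℓm nt j j0 f _)) t (there (there (here refl))) =
    tree<nonTree j j0 ℓ m ℓm (mulVar ℓ f) (mulVar j f) nt

  below⇒different : ∀ t u → rank t <ₗ rank u → sameEdgeK G K u t ≡ false
  below⇒different t u t<u with sameEdgeK G K u t in ut
  ... | false = refl
  ... | true = ⊥-elim (<ₗ-irrefl (rank t) (subst (rank t <ₗ_) (rank-respects u t ut) t<u))

  leading-odd : ∀ idx → coeff (B idx) (leading idx) ≡ true
  leading-odd idx rewrite B-split idx | same-refl (leading idx) =
    cong not (parity-false _ (trailing idx) (λ t t∈ → below⇒different t (leading idx) (trailing-below idx t t∈)))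

  -- indices with equal data are equal, all proof fields being irrelevant
  υ-≡ : ∀ {i j i0 i0' i<j i<j' f0 deg deg' supp supp'} →
    _≡_ {A = Index} (inj₁ (υ i j i0 i<j (f0 , deg) supp)) (inj₁ (υ i j i0' i<j' (f0 , deg') supp'))
  υ-≡ {i0 = i0} {i0'} {i<j} {i<j'} {deg = deg} {deg'} {supp} {supp'}
    rewrite ≤-irrelevant i0 i0' | ≤-irrelevant i<j i<j' | ≡-irrelevant deg deg' | T-irrelevant supp supp' = refl

  ω-≡ : ∀ {ℓ m ℓ<m ℓ<m' ℓm ℓm' nt nt' j j0 j0' f0 deg deg' supp supp'} →
    _≡_ {A = Index} (inj₂ (ω ℓ m ℓ<m ℓm nt j j0 (f0 , deg) supp)) (inj₂ (ω ℓ m ℓ<m' ℓm' nt' j j0' (f0 , deg') supp'))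
  ω-≡ {ℓ<m = ℓ<m} {ℓ<m'} {ℓm} {ℓm'} {nt} {nt'} {j0 = j0} {j0'} {deg = deg} {deg'} {supp} {supp'}
    rewrite ≤-irrelevant ℓ<m ℓ<m' | T-irrelevant ℓm ℓm' | T-irrelevant nt nt' | ≤-irrelevant j0 j0'
          | ≡-irrelevant deg deg' | T-irrelevant supp supp' = refl

  leading-injective : ∀ a b → sameEdgeK G K (leading a) (leading b) ≡ true → a ≡ b
  leading-injective a@(inj₁ (υ i j i0 _ (f0 , _) f-supp)) b@(inj₁ (υ i' j' i0' _ (f0' , _) f-supp')) same
    with same⇒SameEdge (leading a) (leading b) same
  ... | pair , monomial with PairEq-cases pair
  ...   | inj₂ (i≡pi' , pi≡i') =
    ⊥-elim (<-irrefl refl (<-trans (subst (λ z → toℕ z < toℕ i') (sym i≡pi') (parent-< i' i0'))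
                                     (subst (λ z → toℕ z < toℕ i) pi≡i' (parent-< i i0))))
  ...   | inj₁ (refl , _) with split-unique f0 f0' j j' monomial f-supp f-supp'
  ...     | refl , refl = υ-≡
  leading-injective a@(inj₂ (ω ℓ m ℓ<m _ _ j _ (f0 , _) f-supp)) b@(inj₂ (ω ℓ' m' ℓ'<m' _ _ j' _ (f0' , _) f-supp')) same
    with same⇒SameEdge (leading a) (leading b) same
  ... | same-order , monomial with split-unique f0 f0' j j' monomial f-supp f-supp'
  ...   | refl , refl = ω-≡
  leading-injective a@(inj₂ (ω ℓ m ℓ<m _ _ j _ (f0 , _) f-supp)) b@(inj₂ (ω ℓ' m' ℓ'<m' _ _ j' _ (f0' , _) f-supp')) same
    | swapped , _ = ⊥-elim (<-irrefl refl (<-trans ℓ<m ℓ'<m'))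
  leading-injective a@(inj₁ (υ i _ i0 _ _ _)) b@(inj₂ (ω ℓ m _ _ nt _ _ _ _)) same =
    ⊥-elim (nonTree≢treeEdge ℓ m i i0 nt (PairEq-sym (proj₁ (same⇒SameEdge (leading a) (leading b) same))))
  leading-injective a@(inj₂ (ω ℓ m _ _ nt _ _ _ _)) b@(inj₁ (υ i _ i0 _ _ _)) same =
    ⊥-elim (nonTree≢treeEdge ℓ m i i0 nt (proj₁ (same⇒SameEdge (leading a) (leading b) same)))

  independent : ∀ l → Unique l → span l ≈ [] → l ≡ []
  independent [] _ _ = refl
  independent l@(x ∷ _) unique vanishes with maximum (λ idx → rank (leading idx)) l (here refl)
  ... | top , top∈ , top-max = ⊥-elim (true≢false (trans (sym top-survives) (vanishes (leading top))))
    where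
      occurs : Index → Bool
      occurs y = coeff (B y) (leading top)
      only-top : ∀ y → y ∈ l → occurs y ≡ true → y ≡ top
      only-top y y∈ odd with parity-true (sameEdgeK G K (leading top)) (B y) odd
      ... | t , t∈ , same with subst (t ∈_) (B-split y) t∈
      ...   | here refl = sym (leading-injective top y same)
      ...   | there t∈trailing = ⊥-elim (<ₗ-irrefl (rank t)
                (subst (rank t <ₗ_) (rank-respects (leading top) t same)
                  (<ₗ-≤ₗ-trans (trailing-below y t t∈trailing) (All.lookup top-max y∈))))
      top-survives : coeff (span l) (leading top) ≡ true
      top-survives = trans (parity-concatMap (sameEdgeK G K (leading top)) B l)
                           (parity-unique-hit occurs top l unique top∈ (leading-odd top) only-top)

module Assembly {n : ℕ} (G : SimpleGraph (suc n)) (Tr : BFSTree G) (k' : ℕ) where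
  open Family G Tr k'
  open Reduction G Tr k'
  open Rigidity G Tr k'
  open Independence G Tr k'
  open Parity

  cycles-++ : ∀ x y → InCycles x → InCycles y → InCycles (x ++ y)
  cycles-++ x y cx cy w rewrite parity-++ (incident w) x y | cx w | cy w = refl

  kerP-++ : ∀ x y → InKerP x → InKerP y → InKerP (x ++ y)
  kerP-++ x y kx ky a b rewrite parity-++ (onPair a b) x y | kx a b | ky a b = refl

  -- reduce x modulo ℬ; the canonical remainder is again a cycle in ker p*, hence zero
  spanned : ∀ x → InCycles x → InKerP x → Σ (List Index) λ L → span L ≈ x
  spanned x cyc ker with reduce x
  ... | reduces L r can x≈ = L , λ e → sym (begin
    coeff x e                              ≡⟨ x≈ e ⟩
    coeff (span L ++ r) e                  ≡⟨ coeff-++ (span L) r e ⟩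
    coeff (span L) e xor coeff r e         ≡⟨ cong (coeff (span L) e xor_) (remainder-zero e) ⟩
    coeff (span L) e xor false             ≡⟨ xor-identityʳ _ ⟩
    coeff (span L) e ∎)
    where
      open ≡-Reasoning
      remainder : (x ++ span L) ≈ r
      remainder e = begin
        coeff (x ++ span L) e                            ≡⟨ coeff-++ x (span L) e ⟩
        coeff x e xor coeff (span L) e                   ≡⟨ cong (_xor coeff (span L) e) (trans (x≈ e) (coeff-++ (span L) r e)) ⟩
        (coeff (span L) e xor coeff r e) xor coeff (span L) e ≡⟨ cancel (coeff (span L) e) (coeff r e) ⟩
        coeff r e ∎
        where
          cancel : ∀ s t → (s xor t) xor s ≡ t
          cancel = solve 2 (λ s t → (s :+ t) :+ s := t) refl
            where open xor-∧-Solver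
      remainder-zero : ∀ e → coeff r e ≡ false
      remainder-zero = canonical-zero r can
        (InCycles-≈ (x ++ span L) r remainder (cycles-++ x (span L) cyc (span-cycles L)))
        (InKerP-≈ (x ++ span L) r remainder (kerP-++ x (span L) ker (span-kerP L)))

  inSquareSpace : ∀ L x → span L ≈ x → InSquareSpace G K hk x
  inSquareSpace L x L≈x = map toSquareIndex L , λ e → trans (cong (λ s → coeff s e) (sym (span≡squareSum L))) (L≈x e)

  basis : IsBasisOfSquareSpace G K hk B
  basis = record
    { inSpace  = λ i → inSquareSpace (i ∷ []) (B i) (λ e → cong (λ s → coeff s e) (++-identityʳ (B i)))
    ; linIndep = independent
    ; spans    = λ x sx → let cyc , ker = squareSpace⊆ x sx in spanned x cyc ker
    }

  characterization : ∀ x → InSquareSpace G K hk x ⇔ (InCycleSpace G K (s≤s z≤n) x × _≈G_ G K (pStar G K x) [])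
  characterization x = mk⇔
    (λ sx → let cyc , ker = squareSpace⊆ x sx in Equivalence.from (cycleSpace⇔ x) cyc , Equivalence.from (kerP⇔ x) ker)
    (λ (cyc , ker) → let L , L≈x = spanned x (Equivalence.to (cycleSpace⇔ x) cyc) (Equivalence.to (kerP⇔ x) ker)
                      in inSquareSpace L x L≈x)

proposition5 : ∀ {n : ℕ} (G : SimpleGraph (suc n)) (Tr : BFSTree G) (k : ℕ) (hk : 2 ≤ k)
    → IsBasisOfSquareSpace G k hk (𝓑 G Tr k hk)
      × (∀ (x : EK G k) → InSquareSpace G k hk x ⇔ (InCycleSpace G k (≤-trans (s≤s z≤n) hk) x × _≈G_ G k (pStar G k x) []))
proposition5 G Tr (suc (suc k')) (s≤s (s≤s z≤n)) = basis , characterization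
  where open Assembly G Tr k'
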